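{- Let $Q$ be a delta operator with umbral operator $\phi$, let $A=D/Q$, and for $n\in\mathbb N$ write $\tilde A(t)^n=\sum_{k\ge0}a_k^{(n)}\frac{t^k}{k!}$, where $\tilde A$ is the power series with $A=\tilde A(D)$. Then for $1\le k\le n$, \[ a_{n-k}^{(n)}=\left[{n\atop k}\right]_\phi\binom{n-1}{k-1}^{ -1}. \]
   Context: $\mathbb K$ is a field of characteristic zero; operators are linear maps on $\mathbb K[x]$; $D=d/dx$. Shift-invariant operators (commuting with all shifts) are $\tilde T(D)$ for a unique power series $\tilde T$. A delta operator is a shift-invariant $Q$ with $Qx$ a nonzero constant; then $Q=DP$ with $P$ invertible shift-invariant and $D/Q\defeq P^{ -1}$. The umbral operator $\phi$ is defined by $\phi x^n=\phi_n(x)$ with $(\phi_n)$ the unique polynomial sequence with $\deg\phi_n=n$, $\phi_0=1$, $\phi_n(0)=0$ ($n\ge1$), $Q\phi_n=n\phi_{n-1}$. $\left[{n\atop k}\right]_\phi$ is the coefficient of $x^k$ in $\phi_n(x)$. -}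

module Defs where

open import Level using (Level; _⊔_) renaming (suc to lsuc)
open import Data.Nat using (ℕ; zero; suc; _∸_) renaming (_+_ to _+ℕ_; _<_ to _<ℕ_)
open import Data.Nat.Combinatorics using (_P_; _C_)
open import Relation.Nullary using (¬_)
open import Data.Product using (_×_)
open import Algebra.Bundles using (CommutativeRing)

-- A field: a commutative ring with 0 ≉ 1 and a (total) inverse function
-- satisfying x * x⁻¹ ≈ 1 for every x ≉ 0 (value of 0⁻¹ is irrelevant).
record Field (c ℓ : Level) : Set (lsuc (c ⊔ ℓ)) where
  field
    commRing : CommutativeRing c ℓ
  open CommutativeRing commRing public
  field
    _⁻¹      : Carrier → Carrier
    0≉1      : ¬ (0# ≈ 1#)
    *-inverse : ∀ x → ¬ (x ≈ 0#) → x * (x ⁻¹) ≈ 1#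

module FieldTheory {c ℓ : Level} (K : Field c ℓ) where
  open Field K

  fromℕ : ℕ → Carrier
  fromℕ zero    = 0#
  fromℕ (suc n) = 1# + fromℕ n

  CharZero : Set ℓ
  CharZero = ∀ n → ¬ (fromℕ (suc n) ≈ 0#)

  Σ< : ℕ → (ℕ → Carrier) → Carrier
  Σ< zero    f = 0#
  Σ< (suc n) f = f n + Σ< n f

  Series : Set c
  Series = ℕ → Carrier

  oneS : Series
  oneS zero    = 1#
  oneS (suc _) = 0#

  _·S_ : Series → Series → Series
  (a ·S b) n = Σ< (suc n) (λ i → a i * b (n ∸ i))

  _^S_ : Series → ℕ → Series
  a ^S zero  = oneS
  a ^S suc n = a ·S (a ^S n)

  -- Polynomials are represented by coefficient functions ℕ → K
  -- (coefficient of x^m), together with a degree bound d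
  -- (coefficients above d vanish).
  --
  -- Action of the shift-invariant operator T̃(D) = Σ_j t_j D^j on a
  -- polynomial p of degree ≤ d: the coefficient of x^m in T̃(D) p is
  --   Σ_{j ≤ d} t_j · (m+j)!/m! · p_{m+j}    (D^j x^{m+j} = (m+j)_j x^m).
  applyOp : Series → ℕ → (ℕ → Carrier) → (ℕ → Carrier)
  applyOp t d p m = Σ< (suc d) (λ j → t j * (fromℕ ((m +ℕ j) P j) * p (m +ℕ j)))

  -- Q̃ is the series of a delta operator Q = Q̃(D): Qx is a nonzero constant,
  -- i.e. q₀ = 0 and q₁ ≠ 0.
  IsDelta : Series → Set ℓ
  IsDelta q = (q 0 ≈ 0#) × ¬ (q 1 ≈ 0#)

  -- Q = D P with P̃(t) = Q̃(t)/t, i.e. P̃(t) = Σ_j q_{j+1} t^j.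
  Pseries : Series → Series
  Pseries q j = q (suc j)

  -- Ã is the series of A = D/Q = P⁻¹: Ã · P̃ = 1.
  IsDOverQ : Series → Series → Set ℓ
  IsDOverQ q a = ∀ n → (a ·S Pseries q) n ≈ oneS n

  -- φ n k = coefficient of x^k in φ_n(x).  (φ_n) is the basic sequence of
  -- the delta operator Q̃(D): deg φ_n = n, φ_0 = 1, φ_n(0) = 0 for n ≥ 1,
  -- Q φ_n = n φ_{n-1}.
  record IsBasicSeq (q : Series) (φ : ℕ → ℕ → Carrier) : Set (c ⊔ ℓ) where
    field
      deg-bound : ∀ n k → n <ℕ k → φ n k ≈ 0#
      deg-exact : ∀ n → ¬ (φ n n ≈ 0#)
      φ₀        : ∀ k → φ 0 k ≈ oneS k
      vanish₀   : ∀ n → φ (suc n) 0 ≈ 0#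
      lowering  : ∀ n m → applyOp q (suc n) (φ (suc n)) m ≈ fromℕ (suc n) * φ n m

{-# OPTIONS --safe #-}

-- Write φ̂ₙ(k) = k! [xᵏ] φₙ. In the basis xᵏ/k! the operator Q̃(D) acts by the Toeplitz matrix
-- of (q_j), so Qφₙ₊₁ = (n+1)φₙ becomes Σ_j q_j φ̂ₙ₊₁(m+j) = (n+1) φ̂ₙ(m). Since q₀ = 0 and
-- q₁ ≠ 0 this system is triangular, and with deg φₙ₊₁ ≤ n+1 and φₙ₊₁(0) = 0 it determines
-- φ̂ₙ₊₁ from φ̂ₙ. The candidate ψₙ(k) = k (n-1)! [t^(n-k)] Ãⁿ of the transfer formula
-- φₙ = x Aⁿ x^(n-1) satisfies the same system: via Ã P̃ = 1 this reduces to the identity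
-- θ(Ãⁿ) + n Ãⁿ⁺¹ θP̃ = 0 for the Euler operator θ = t d/dt, which follows from the Leibniz
-- rule. Hence φ̂ₙ = ψₙ, and dividing by k! gives the stated binomial form.

module Submission where

open import Defs
open import Level using (Level)
open import Data.Nat using (ℕ; _≤_; _∸_)
open import Data.Nat.Combinatorics using (_C_)
open import Data.Nat using (_!)

open import Data.Nat using (zero; suc; _<_; _≤?_; s≤s; NonZero) renaming (_+_ to _+ℕ_; _*_ to _*ℕ_)
import Data.Nat.Properties as ℕ
open import Relation.Binary.PropositionalEquality as ≡ using (_≡_)
open import Relation.Nullary using (¬_; yes; no; contradiction)
open import Data.Nat.Combinatorics using (_P_; nCk≡n!/k![n-k]!; k![n∸k]!∣n!)
open import Data.Nat.Combinatorics.Specification using (nPk≡n!/[n∸k]!)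
open import Data.Nat.Divisibility using (m≤n⇒m!∣n!)
open import Data.Nat.DivMod using (_/_; m*[n/m]≡n; m/n*n≡m)
open import Data.Product using (_,_; proj₁)
open import Data.Nat.Tactic.RingSolver using (solve-∀)
open import Algebra.Bundles using (CommutativeSemiring)

m!*[m+j]Pj≡[m+j]! : ∀ m j → m ! *ℕ ((m +ℕ j) P j) ≡ (m +ℕ j) !
m!*[m+j]Pj≡[m+j]! m j = begin
  m ! *ℕ ((m +ℕ j) P j)      ≡⟨ ≡.cong (λ i → i ! *ℕ ((m +ℕ j) P j)) (ℕ.m+n∸n≡m m j) ⟨
  l ! *ℕ ((m +ℕ j) P j)      ≡⟨ ≡.cong (l ! *ℕ_) (nPk≡n!/[n∸k]! (ℕ.m≤n+m j m)) ⟩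
  l ! *ℕ ((m +ℕ j) ! / l !)  ≡⟨ m*[n/m]≡n (m≤n⇒m!∣n! (ℕ.m∸n≤m (m +ℕ j) j)) ⟩
  (m +ℕ j) !                 ∎
  where
  open ≡.≡-Reasoning
  l = m +ℕ j ∸ j
  instance _ = l ℕ.!≢0

binomial-factorials : ∀ {n k} → k ≤ n → (n C k) *ℕ (k ! *ℕ (n ∸ k) !) ≡ n !
binomial-factorials {n} {k} k≤n =
  ≡.trans (≡.cong (_*ℕ (k ! *ℕ (n ∸ k) !)) (nCk≡n!/k![n-k]! k≤n)) (m/n*n≡m (k![n∸k]!∣n! k≤n))
  where instance _ = k ℕ.!* (n ∸ k) !≢0

nCk≢0 : ∀ {n k} → k ≤ n → NonZero (n C k)
nCk≢0 {n} {k} k≤n =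
  ℕ.m*n≢0⇒m≢0 (n C k) {{≡.subst NonZero (≡.sym (binomial-factorials k≤n)) (n ℕ.!≢0)}}

[1+k]*n!≡[1+k]!*[nCk*[n∸k]!] : ∀ {n k} → k ≤ n → suc k *ℕ n ! ≡ suc k ! *ℕ ((n C k) *ℕ (n ∸ k) !)
[1+k]*n!≡[1+k]!*[nCk*[n∸k]!] {n} {k} k≤n =
  ≡.trans (≡.cong (suc k *ℕ_) (≡.sym (binomial-factorials k≤n)))
          (regroup (suc k) (n C k) (k !) ((n ∸ k) !))
  where
  regroup : ∀ x y z w → x *ℕ (y *ℕ (z *ℕ w)) ≡ x *ℕ z *ℕ (y *ℕ w)
  regroup = solve-∀

module FieldArithmetic {c ℓ : Level} (K : Field c ℓ) where
  open Field K
  open FieldTheory K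
  open import Algebra.Properties.Semiring.Mult semiring using (_×_; ×-homo-+; ×1-homo-*)
  open import Relation.Binary.Reasoning.Setoid setoid

  fromℕ≡×1 : ∀ n → fromℕ n ≡ n × 1#
  fromℕ≡×1 zero    = ≡.refl
  fromℕ≡×1 (suc n) = ≡.cong (1# +_) (fromℕ≡×1 n)

  fromℕ-+ : ∀ m n → fromℕ (m +ℕ n) ≈ fromℕ m + fromℕ n
  fromℕ-+ m n rewrite fromℕ≡×1 (m +ℕ n) | fromℕ≡×1 m | fromℕ≡×1 n = ×-homo-+ 1# m n

  fromℕ-* : ∀ m n → fromℕ (m *ℕ n) ≈ fromℕ m * fromℕ n
  fromℕ-* m n rewrite fromℕ≡×1 (m *ℕ n) | fromℕ≡×1 m | fromℕ≡×1 n = ×1-homo-* m n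

  fromℕ-nonZero : CharZero → ∀ n .{{_ : NonZero n}} → ¬ fromℕ n ≈ 0#
  fromℕ-nonZero char0 (suc n) = char0 n

  *-cancelˡ-nonZero : ∀ x y z → ¬ x ≈ 0# → x * y ≈ x * z → y ≈ z
  *-cancelˡ-nonZero x y z x≉0 xy≈xz = begin
    y              ≈⟨ cancel y ⟨
    x ⁻¹ * (x * y) ≈⟨ *-congˡ xy≈xz ⟩
    x ⁻¹ * (x * z) ≈⟨ cancel z ⟩
    z              ∎
    where
    cancel : ∀ w → x ⁻¹ * (x * w) ≈ w
    cancel w = trans (sym (*-assoc _ _ _))
      (trans (*-congʳ (trans (*-comm _ _) (*-inverse x x≉0))) (*-identityˡ w))

  y≈x*z⇒z≈y*x⁻¹ : ∀ {x y z} → ¬ x ≈ 0# → y ≈ x * z → z ≈ y * x ⁻¹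
  y≈x*z⇒z≈y*x⁻¹ {x} {y} {z} x≉0 y≈x*z = begin
    z                ≈⟨ *-identityʳ z ⟨
    z * 1#           ≈⟨ *-congˡ (*-inverse x x≉0) ⟨
    z * (x * x ⁻¹)   ≈⟨ *-assoc z x (x ⁻¹) ⟨
    z * x * x ⁻¹     ≈⟨ *-congʳ (trans (*-comm z x) (sym y≈x*z)) ⟩
    y * x ⁻¹         ∎

module FiniteSums {c ℓ : Level} (K : Field c ℓ) where
  open Field K
  open FieldTheory K
  open import Algebra.Properties.CommutativeSemigroup +-commutativeSemigroup using (interchange)
  open import Relation.Binary.Reasoning.Setoid setoid

  Σ<-cong : ∀ n {f g : ℕ → Carrier} → (∀ i → i < n → f i ≈ g i) → Σ< n f ≈ Σ< n g
  Σ<-cong zero    f≈g = refl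
  Σ<-cong (suc n) f≈g = +-cong (f≈g n ℕ.≤-refl) (Σ<-cong n (λ i i<n → f≈g i (ℕ.m<n⇒m<1+n i<n)))

  Σ<-zero : ∀ n {f : ℕ → Carrier} → (∀ i → i < n → f i ≈ 0#) → Σ< n f ≈ 0#
  Σ<-zero zero    f≈0 = refl
  Σ<-zero (suc n) f≈0 =
    trans (+-cong (f≈0 n ℕ.≤-refl) (Σ<-zero n (λ i i<n → f≈0 i (ℕ.m<n⇒m<1+n i<n)))) (+-identityʳ 0#)

  Σ<-+ : ∀ n (f g : ℕ → Carrier) → Σ< n (λ i → f i + g i) ≈ Σ< n f + Σ< n g
  Σ<-+ zero    f g = sym (+-identityʳ 0#)
  Σ<-+ (suc n) f g = trans (+-congˡ (Σ<-+ n f g)) (interchange _ _ _ _)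

  *-distribˡ-Σ< : ∀ n x (f : ℕ → Carrier) → x * Σ< n f ≈ Σ< n (λ i → x * f i)
  *-distribˡ-Σ< zero    x f = zeroʳ x
  *-distribˡ-Σ< (suc n) x f = trans (distribˡ x (f n) (Σ< n f)) (+-congˡ (*-distribˡ-Σ< n x f))

  *-distribʳ-Σ< : ∀ n x (f : ℕ → Carrier) → Σ< n f * x ≈ Σ< n (λ i → f i * x)
  *-distribʳ-Σ< zero    x f = zeroˡ x
  *-distribʳ-Σ< (suc n) x f = trans (distribʳ x (f n) (Σ< n f)) (+-congˡ (*-distribʳ-Σ< n x f))

  Σ<-shift : ∀ n (f : ℕ → Carrier) → Σ< (suc n) f ≈ Σ< n (λ i → f (suc i)) + f 0
  Σ<-shift zero    f = +-comm (f 0) 0#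
  Σ<-shift (suc n) f = trans (+-congˡ (Σ<-shift n f)) (sym (+-assoc _ _ _))

  Σ<-truncate : ∀ n b {f : ℕ → Carrier} → (∀ i → n ≤ i → f i ≈ 0#) → Σ< (b +ℕ n) f ≈ Σ< n f
  Σ<-truncate n zero    f≈0 = refl
  Σ<-truncate n (suc b) f≈0 =
    trans (+-cong (f≈0 (b +ℕ n) (ℕ.m≤n+m n b)) (Σ<-truncate n b f≈0)) (+-identityˡ _)

  Σ<-reverse : ∀ n (f : ℕ → Carrier) → Σ< (suc n) f ≈ Σ< (suc n) (λ i → f (n ∸ i))
  Σ<-reverse zero    f = refl
  Σ<-reverse (suc n) f = begin
    f (suc n) + Σ< (suc n) f                       ≈⟨ +-congˡ (Σ<-reverse n f) ⟩
    f (suc n) + Σ< (suc n) (λ i → f (n ∸ i))       ≈⟨ +-comm _ _ ⟩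
    Σ< (suc n) (λ i → f (n ∸ i)) + f (suc n)       ≈⟨ Σ<-shift (suc n) (λ i → f (suc n ∸ i)) ⟨
    Σ< (suc (suc n)) (λ i → f (suc n ∸ i))         ∎

  Σ<-triangle : ∀ n (F : ℕ → ℕ → Carrier) →
    Σ< (suc n) (λ i → Σ< (suc i) (F i)) ≈ Σ< (suc n) (λ j → Σ< (suc (n ∸ j)) (λ l → F (j +ℕ l) j))
  Σ<-triangle zero    F = refl
  Σ<-triangle (suc n) F = begin
    Σ< (suc (suc n)) (F (suc n)) + Σ< (suc n) (λ i → Σ< (suc i) (F i))
      ≈⟨ +-congˡ (Σ<-triangle n F) ⟩
    (F (suc n) (suc n) + Σ< (suc n) (F (suc n))) + Σ< (suc n) (column n)
      ≈⟨ +-assoc _ _ _ ⟩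
    F (suc n) (suc n) + (Σ< (suc n) (F (suc n)) + Σ< (suc n) (column n))
      ≈⟨ +-cong (sym (+-identityʳ _)) (sym (trans (Σ<-cong (suc n) column-suc) (Σ<-+ (suc n) _ _))) ⟩
    (F (suc n) (suc n) + 0#) + Σ< (suc n) (column (suc n))
      ≈⟨ +-congʳ column-diagonal ⟨
    Σ< (suc (suc n)) (column (suc n))
      ∎
    where
    column : ℕ → ℕ → Carrier
    column n j = Σ< (suc (n ∸ j)) (λ l → F (j +ℕ l) j)
    column-diagonal : column (suc n) (suc n) ≈ F (suc n) (suc n) + 0#
    column-diagonal rewrite ℕ.n∸n≡0 n | ℕ.+-identityʳ n = refl
    column-suc : ∀ j → j < suc n → column (suc n) j ≈ F (suc n) j + column n j
    column-suc j (s≤s j≤n) rewrite ℕ.+-∸-assoc 1 j≤n = +-congʳ (reflexive (≡.cong (λ i → F i j)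
      (≡.trans (ℕ.+-suc j (n ∸ j)) (≡.cong suc (ℕ.m+[n∸m]≡n j≤n)))))

module FormalPowerSeries {c ℓ : Level} (K : Field c ℓ) where
  open Field K
  open FieldTheory K
  open FieldArithmetic K
  open FiniteSums K
  open import Relation.Binary.Reasoning.Setoid setoid
  open import Algebra.Solver.Ring.NaturalCoefficients.Default commutativeSemiring
    using (solve; _:=_; _:+_; _:*_)
  import Algebra.Construct.Pointwise ℕ as Pointwise

  infix  4 _≈S_
  infixl 6 _+S_

  _≈S_ : Series → Series → Set ℓ
  a ≈S b = ∀ n → a n ≈ b n

  _+S_ : Series → Series → Series
  (a +S b) n = a n + b n

  0S : Series
  0S _ = 0#

  ·S-cong : ∀ {a a′ b b′} → a ≈S a′ → b ≈S b′ → a ·S b ≈S a′ ·S b′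
  ·S-cong a≈a′ b≈b′ n = Σ<-cong (suc n) (λ i _ → *-cong (a≈a′ i) (b≈b′ (n ∸ i)))

  ·S-comm : ∀ a b → a ·S b ≈S b ·S a
  ·S-comm a b n = begin
    Σ< (suc n) (λ i → a i * b (n ∸ i))             ≈⟨ Σ<-reverse n _ ⟩
    Σ< (suc n) (λ i → a (n ∸ i) * b (n ∸ (n ∸ i))) ≈⟨ Σ<-cong (suc n) swap ⟩
    Σ< (suc n) (λ i → b i * a (n ∸ i))             ∎
    where
    swap : ∀ i → i < suc n → a (n ∸ i) * b (n ∸ (n ∸ i)) ≈ b i * a (n ∸ i)
    swap i (s≤s i≤n) = trans (*-comm _ _) (*-congʳ (reflexive (≡.cong b (ℕ.m∸[m∸n]≡n i≤n))))

  ·S-assoc : ∀ a b c → (a ·S b) ·S c ≈S a ·S (b ·S c)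
  ·S-assoc a b c n = begin
    Σ< (suc n) (λ i → (a ·S b) i * c (n ∸ i))
      ≈⟨ Σ<-cong (suc n) (λ i _ → *-distribʳ-Σ< (suc i) (c (n ∸ i)) _) ⟩
    Σ< (suc n) (λ i → Σ< (suc i) (λ j → (a j * b (i ∸ j)) * c (n ∸ i)))
      ≈⟨ Σ<-triangle n (λ i j → (a j * b (i ∸ j)) * c (n ∸ i)) ⟩
    Σ< (suc n) (λ j → Σ< (suc (n ∸ j)) (λ l → (a j * b (j +ℕ l ∸ j)) * c (n ∸ (j +ℕ l))))
      ≈⟨ Σ<-cong (suc n) (λ j _ → Σ<-cong (suc (n ∸ j)) (λ l _ → reindex j l)) ⟩
    Σ< (suc n) (λ j → Σ< (suc (n ∸ j)) (λ l → a j * (b l * c (n ∸ j ∸ l))))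
      ≈⟨ Σ<-cong (suc n) (λ j _ → *-distribˡ-Σ< (suc (n ∸ j)) (a j) _) ⟨
    Σ< (suc n) (λ j → a j * (b ·S c) (n ∸ j))
      ∎
    where
    reindex : ∀ j l → (a j * b (j +ℕ l ∸ j)) * c (n ∸ (j +ℕ l)) ≈ a j * (b l * c (n ∸ j ∸ l))
    reindex j l = trans (*-assoc _ _ _) (*-congˡ (*-cong
      (reflexive (≡.cong b (ℕ.m+n∸m≡n j l)))
      (reflexive (≡.cong c (≡.sym (ℕ.∸-+-assoc n j l))))))

  constS : Carrier → Series
  constS x zero    = x
  constS x (suc _) = 0#

  constS-·S : ∀ x a n → (constS x ·S a) n ≈ x * a n
  constS-·S x a n = begin
    Σ< (suc n) (λ i → constS x i * a (n ∸ i))  ≈⟨ Σ<-shift n _ ⟩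
    Σ< n (λ i → 0# * a (n ∸ suc i)) + x * a n  ≈⟨ +-congʳ (Σ<-zero n (λ i _ → zeroˡ _)) ⟩
    0# + x * a n                               ≈⟨ +-identityˡ _ ⟩
    x * a n                                    ∎

  constS-+ : ∀ x y → constS (x + y) ≈S constS x +S constS y
  constS-+ x y zero    = refl
  constS-+ x y (suc n) = sym (+-identityʳ 0#)

  constS-1# : constS 1# ≈S oneS
  constS-1# zero    = refl
  constS-1# (suc n) = refl

  ·S-identityˡ : ∀ a → oneS ·S a ≈S a
  ·S-identityˡ a n =
    trans (·S-cong {b = a} (λ i → sym (constS-1# i)) (λ _ → refl) n)
          (trans (constS-·S 1# a n) (*-identityˡ _))

  ·S-distribʳ : ∀ c a b → (a +S b) ·S c ≈S a ·S c +S b ·S c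
  ·S-distribʳ c a b n = trans (Σ<-cong (suc n) (λ i _ → distribʳ _ _ _)) (Σ<-+ (suc n) _ _)

  ·S-zeroˡ : ∀ a → 0S ·S a ≈S 0S
  ·S-zeroˡ a n = Σ<-zero (suc n) (λ i _ → zeroˡ _)

  series-commutativeSemiring : CommutativeSemiring c ℓ
  series-commutativeSemiring = record
    { Carrier = Series
    ; _≈_ = _≈S_
    ; _+_ = _+S_
    ; _*_ = _·S_
    ; 0# = 0S
    ; 1# = oneS
    ; isCommutativeSemiring = isCommutativeSemiringˡ record
      { +-isCommutativeMonoid = Pointwise.isCommutativeMonoid +-isCommutativeMonoid
      ; *-isCommutativeMonoid = isCommutativeMonoidˡ record
        { isSemigroup = record
          { isMagma = record
            { isEquivalence = Pointwise.isEquivalence isEquivalence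
            ; ∙-cong = ·S-cong
            }
          ; assoc = ·S-assoc
          }
        ; identityˡ = ·S-identityˡ
        ; comm = ·S-comm
        }
      ; distribʳ = ·S-distribʳ
      ; zeroˡ = ·S-zeroˡ
      }
    }
    where open import Algebra.Structures.Biased _≈S_ using (isCommutativeSemiringˡ; isCommutativeMonoidˡ)

  θ : Series → Series
  θ a n = fromℕ n * a n

  θ-cong : ∀ {a b} → a ≈S b → θ a ≈S θ b
  θ-cong a≈b n = *-congˡ (a≈b n)

  θ-oneS : θ oneS ≈S 0S
  θ-oneS zero    = zeroˡ 1#
  θ-oneS (suc n) = zeroʳ _

  θ-·S : ∀ a b → θ (a ·S b) ≈S θ a ·S b +S a ·S θ b
  θ-·S a b n = begin
    fromℕ n * Σ< (suc n) (λ i → a i * b (n ∸ i))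
      ≈⟨ *-distribˡ-Σ< (suc n) _ _ ⟩
    Σ< (suc n) (λ i → fromℕ n * (a i * b (n ∸ i)))
      ≈⟨ Σ<-cong (suc n) split ⟩
    Σ< (suc n) (λ i → θ a i * b (n ∸ i) + a i * θ b (n ∸ i))
      ≈⟨ Σ<-+ (suc n) _ _ ⟩
    (θ a ·S b) n + (a ·S θ b) n
      ∎
    where
    leibniz : ∀ x y u v → (x + y) * (u * v) ≈ x * u * v + u * (y * v)
    leibniz = solve 4 (λ x y u v → (x :+ y) :* (u :* v) := x :* u :* v :+ u :* (y :* v)) refl
    split : ∀ i → i < suc n → fromℕ n * (a i * b (n ∸ i)) ≈ θ a i * b (n ∸ i) + a i * θ b (n ∸ i)
    split i (s≤s i≤n) = begin
      fromℕ n * (a i * b (n ∸ i))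
        ≈⟨ *-congʳ (reflexive (≡.cong fromℕ (≡.sym (ℕ.m+[n∸m]≡n i≤n)))) ⟩
      fromℕ (i +ℕ (n ∸ i)) * (a i * b (n ∸ i))
        ≈⟨ *-congʳ (fromℕ-+ i (n ∸ i)) ⟩
      (fromℕ i + fromℕ (n ∸ i)) * (a i * b (n ∸ i))
        ≈⟨ leibniz _ _ _ _ ⟩
      θ a i * b (n ∸ i) + a i * θ b (n ∸ i)
        ∎

  ·S-weighted : ∀ m a b s →
    Σ< (suc s) (λ i → fromℕ (m +ℕ i) * (a i * b (s ∸ i))) ≈ fromℕ m * (a ·S b) s + (θ a ·S b) s
  ·S-weighted m a b s = begin
    Σ< (suc s) (λ i → fromℕ (m +ℕ i) * (a i * b (s ∸ i)))
      ≈⟨ Σ<-cong (suc s) (λ i _ → trans (*-congʳ (fromℕ-+ m i)) (split _ _ _ _)) ⟩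
    Σ< (suc s) (λ i → fromℕ m * (a i * b (s ∸ i)) + θ a i * b (s ∸ i))
      ≈⟨ Σ<-+ (suc s) _ _ ⟩
    Σ< (suc s) (λ i → fromℕ m * (a i * b (s ∸ i))) + (θ a ·S b) s
      ≈⟨ +-congʳ (*-distribˡ-Σ< (suc s) _ _) ⟨
    fromℕ m * (a ·S b) s + (θ a ·S b) s
      ∎
    where
    split : ∀ x y u v → (x + y) * (u * v) ≈ x * (u * v) + y * u * v
    split = solve 4 (λ x y u v → (x :+ y) :* (u :* v) := x :* (u :* v) :+ y :* u :* v) refl

  reversal : ℕ → Series → ℕ → Carrier
  reversal N u k with k ≤? N
  ... | yes _ = u (N ∸ k)
  ... | no  _ = 0#

  reversal-≤ : ∀ N u {k} → k ≤ N → reversal N u k ≡ u (N ∸ k)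
  reversal-≤ N u {k} k≤N with k ≤? N
  ... | yes _   = ≡.refl
  ... | no  k≰N = contradiction k≤N k≰N

  reversal-> : ∀ N u {k} → N < k → reversal N u k ≡ 0#
  reversal-> N u {k} N<k with k ≤? N
  ... | yes k≤N = contradiction k≤N (ℕ.<⇒≱ N<k)
  ... | no  _   = ≡.refl

module DeltaOperators {c ℓ : Level} (K : Field c ℓ) where
  open Field K
  open FieldTheory K
  open FieldArithmetic K
  open FiniteSums K
  open import Algebra.Properties.Group +-group using (∙-cancelˡ)
  open import Algebra.Solver.Ring.NaturalCoefficients.Default commutativeSemiring
    using (solve; _:=_; _:*_)
  open import Relation.Binary.Reasoning.Setoid setoid

  toeplitz : Series → ℕ → (ℕ → Carrier) → ℕ → Carrier
  toeplitz t d u m = Σ< (suc d) (λ j → t j * u (m +ℕ j))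

  divided : (ℕ → Carrier) → ℕ → Carrier
  divided f k = fromℕ (k !) * f k

  -- In the basis xᵏ/k! the operator Dʲ only shifts indices by j.
  applyOp≈toeplitz-divided : ∀ t d f m → fromℕ (m !) * applyOp t d f m ≈ toeplitz t d (divided f) m
  applyOp≈toeplitz-divided t d f m = begin
    fromℕ (m !) * applyOp t d f m
      ≈⟨ *-distribˡ-Σ< (suc d) _ _ ⟩
    Σ< (suc d) (λ j → fromℕ (m !) * (t j * (fromℕ ((m +ℕ j) P j) * f (m +ℕ j))))
      ≈⟨ Σ<-cong (suc d) (λ j _ → trans (regroup _ _ _ _) (*-congˡ (*-congʳ (factorials j)))) ⟩
    toeplitz t d (divided f) m
      ∎
    where
    regroup : ∀ x y u v → x * (y * (u * v)) ≈ y * ((x * u) * v)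
    regroup = solve 4 (λ x y u v → x :* (y :* (u :* v)) := y :* ((x :* u) :* v)) refl
    factorials : ∀ j → fromℕ (m !) * fromℕ ((m +ℕ j) P j) ≈ fromℕ ((m +ℕ j) !)
    factorials j = trans (sym (fromℕ-* (m !) _)) (reflexive (≡.cong fromℕ (m!*[m+j]Pj≡[m+j]! m j)))

  toeplitz-leading : ∀ {q} → q 0 ≈ 0# → ∀ n u m →
    toeplitz q (suc n) u m ≈ Σ< n (λ i → q (suc (suc i)) * u (suc (suc (m +ℕ i)))) + q 1 * u (suc m)
  toeplitz-leading {q} q0≈0 n u m = begin
    Σ< (suc (suc n)) term
      ≈⟨ Σ<-shift (suc n) term ⟩
    Σ< (suc n) (λ j → term (suc j)) + term 0
      ≈⟨ +-cong (Σ<-shift n (λ j → term (suc j))) (trans (*-congʳ q0≈0) (zeroˡ _)) ⟩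
    Σ< n (λ i → term (suc (suc i))) + term 1 + 0#
      ≈⟨ +-identityʳ _ ⟩
    Σ< n (λ i → term (suc (suc i))) + term 1
      ≈⟨ +-cong (Σ<-cong n (λ i _ → *-congˡ (reflexive (≡.cong u (m+2+i≡2+m+i i)))))
                (*-congˡ (reflexive (≡.cong u (ℕ.+-comm m 1)))) ⟩
    Σ< n (λ i → q (suc (suc i)) * u (suc (suc (m +ℕ i)))) + q 1 * u (suc m)
      ∎
    where
    term : ℕ → Carrier
    term j = q j * u (m +ℕ j)
    m+2+i≡2+m+i : ∀ i → m +ℕ suc (suc i) ≡ suc (suc (m +ℕ i))
    m+2+i≡2+m+i i = ≡.trans (ℕ.+-suc m (suc i)) (≡.cong suc (ℕ.+-suc m i))

  toeplitz-injective : ∀ {q} → IsDelta q → ∀ n {u v : ℕ → Carrier} →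
    (∀ k → suc n < k → u k ≈ 0#) → (∀ k → suc n < k → v k ≈ 0#) → u 0 ≈ v 0 →
    (∀ m → m ≤ n → toeplitz q (suc n) u m ≈ toeplitz q (suc n) v m) →
    ∀ k → u k ≈ v k
  toeplitz-injective {q} (q0≈0 , q1≉0) n {u} {v} u-deg v-deg u0≈v0 toeplitz-eq k =
    agree (suc (suc n)) k (ℕ.m≤m+n (suc (suc n)) k)
    where
    -- Downward induction from the top degree: equation m, whose leading coefficient is
    -- q₁ ≠ 0, determines u (m + 1) from the coefficients above it.
    agree : ∀ d k → suc n < d +ℕ k → u k ≈ v k
    agree zero    k       n<k = trans (u-deg k n<k) (sym (v-deg k n<k))
    agree (suc d) zero    _   = u0≈v0
    agree (suc d) (suc m) n<d+k with suc m ≤? suc n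
    ... | no  m≮n = let n<m = ℕ.≰⇒> m≮n in trans (u-deg (suc m) n<m) (sym (v-deg (suc m) n<m))
    ... | yes (s≤s m≤n) = *-cancelˡ-nonZero (q 1) _ _ q1≉0 (∙-cancelˡ (tail v) _ _ (begin
      tail v + q 1 * u (suc m) ≈⟨ +-congʳ tails-agree ⟨
      tail u + q 1 * u (suc m) ≈⟨ toeplitz-leading q0≈0 n u m ⟨
      toeplitz q (suc n) u m   ≈⟨ toeplitz-eq m m≤n ⟩
      toeplitz q (suc n) v m   ≈⟨ toeplitz-leading q0≈0 n v m ⟩
      tail v + q 1 * v (suc m) ∎))
      where
      tail : (ℕ → Carrier) → Carrier
      tail w = Σ< n (λ i → q (suc (suc i)) * w (suc (suc (m +ℕ i))))
      bound : ∀ i → suc n < d +ℕ suc (suc (m +ℕ i))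
      bound i = ℕ.<-≤-trans (≡.subst (suc n <_) (≡.sym (ℕ.+-suc d (suc m))) n<d+k)
                            (ℕ.+-monoʳ-≤ d (s≤s (s≤s (ℕ.m≤m+n m i))))
      tails-agree : tail u ≈ tail v
      tails-agree = Σ<-cong n (λ i _ → *-congˡ (agree d (suc (suc (m +ℕ i))) (bound i)))

module TransferFormula {c ℓ : Level} (K : Field c ℓ) (q a : FieldTheory.Series K)
                       (a·p≈1 : FieldTheory.IsDOverQ K q a) where
  open Field K
  open FieldTheory K
  open FormalPowerSeries K

  p : Series
  p = Pseries q

  module _ where
    module S = CommutativeSemiring series-commutativeSemiring
    open import Relation.Binary.Reasoning.Setoid S.setoid
    open import Algebra.Solver.Ring.NaturalCoefficients.Default series-commutativeSemiring
      using (solve; _:=_; _:+_; _:*_; con)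

    p·a^[1+n]≈a^n : ∀ n → p ·S (a ^S suc n) ≈S a ^S n
    p·a^[1+n]≈a^n n = begin
      p ·S (a ·S (a ^S n)) ≈⟨ solve 3 (λ p a x → p :* (a :* x) := (a :* p) :* x) S.refl p a (a ^S n) ⟩
      (a ·S p) ·S (a ^S n) ≈⟨ S.*-congʳ {a ^S n} a·p≈1 ⟩
      oneS ·S (a ^S n)     ≈⟨ S.*-identityˡ _ ⟩
      a ^S n               ∎

    θa+a²θp≈0 : θ a +S (a ·S a) ·S θ p ≈S 0S
    θa+a²θp≈0 = begin
      θ a +S (a ·S a) ·S θ p
        ≈⟨ S.+-congʳ (S.trans (S.*-congˡ a·p≈1) (S.*-identityʳ (θ a))) ⟨
      θ a ·S (a ·S p) +S (a ·S a) ·S θ p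
        ≈⟨ solve 4 (λ θa a p θp → θa :* (a :* p) :+ (a :* a) :* θp := a :* (θa :* p :+ a :* θp)) S.refl
                   (θ a) a p (θ p) ⟩
      a ·S (θ a ·S p +S a ·S θ p)
        ≈⟨ S.*-congˡ (θ-·S a p) ⟨
      a ·S θ (a ·S p)
        ≈⟨ S.*-congˡ (S.trans (θ-cong a·p≈1) θ-oneS) ⟩
      a ·S 0S
        ≈⟨ S.zeroʳ a ⟩
      0S
        ∎

    θa^n+nθp·a^[1+n]≈0 : ∀ n → θ (a ^S n) +S constS (fromℕ n) ·S (θ p ·S (a ^S suc n)) ≈S 0S
    θa^n+nθp·a^[1+n]≈0 zero s =
      trans (+-cong (θ-oneS s) (trans (constS-·S 0# (θ p ·S (a ^S 1)) s) (zeroˡ _))) (+-identityʳ 0#)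
    θa^n+nθp·a^[1+n]≈0 (suc n) = begin
      θ (a ·S A) +S constS (1# + fromℕ n) ·S (θ p ·S (a ·S (a ·S A)))
        ≈⟨ S.+-cong (θ-·S a A) (S.*-congʳ {θ p ·S (a ^S suc (suc n))}
                                           (S.trans (constS-+ 1# _) (S.+-congʳ constS-1#))) ⟩
      (θ a ·S A +S a ·S θ A) +S (oneS +S N) ·S (θ p ·S (a ·S (a ·S A)))
        ≈⟨ solve 6 (λ θa θA θp a A N →
                     (θa :* A :+ a :* θA) :+ (con 1 :+ N) :* (θp :* (a :* (a :* A)))
                  := (θa :+ (a :* a) :* θp) :* A :+ a :* (θA :+ N :* (θp :* (a :* A))))
                  S.refl (θ a) (θ A) (θ p) a A N ⟩
      (θ a +S (a ·S a) ·S θ p) ·S A +S a ·S (θ A +S N ·S (θ p ·S (a ^S suc n)))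
        ≈⟨ S.+-cong (S.*-congʳ {A} θa+a²θp≈0) (S.*-congˡ (θa^n+nθp·a^[1+n]≈0 n)) ⟩
      0S ·S A +S a ·S 0S
        ≈⟨ S.trans (S.+-cong (S.zeroˡ A) (S.zeroʳ a)) (S.+-identityʳ 0S) ⟩
      0S
        ∎
      where
      A = a ^S n
      N = constS (fromℕ n)

  open FieldArithmetic K
  open FiniteSums K
  open DeltaOperators K
  open import Relation.Binary.Reasoning.Setoid setoid
  open import Algebra.Solver.Ring.NaturalCoefficients.Default commutativeSemiring
    using (solve; _:=_; _:+_; _:*_)

  -- k! [xᵏ] (x Aⁿ x^(n-1)) for n ≥ 1, by the transfer formula.
  transfer : ℕ → ℕ → Carrier
  transfer zero    k = oneS k
  transfer (suc n) k = fromℕ (k *ℕ n !) * reversal (suc n) (a ^S suc n) k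

  toeplitz-transfer : q 0 ≈ 0# → ∀ n m → m ≤ n →
    toeplitz q (suc n) (transfer (suc n)) m ≈
    fromℕ (n !) * Σ< (suc (n ∸ m)) (λ i → fromℕ (suc m +ℕ i) * (p i * (a ^S suc n) (n ∸ m ∸ i)))
  toeplitz-transfer q0≈0 n m m≤n = begin
    Σ< (suc (suc n)) T
      ≡⟨ ≡.cong (λ l → Σ< l T) length ⟩
    Σ< (m +ℕ suc (suc s)) T
      ≈⟨ Σ<-truncate (suc (suc s)) m T-vanishes ⟩
    Σ< (suc (suc s)) T
      ≈⟨ Σ<-shift (suc s) T ⟩
    Σ< (suc s) (λ i → T (suc i)) + T 0
      ≈⟨ +-cong (Σ<-cong (suc s) T-suc) (trans (*-congʳ q0≈0) (zeroˡ _)) ⟩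
    Σ< (suc s) (λ i → fromℕ (n !) * W i) + 0#
      ≈⟨ trans (+-identityʳ _) (sym (*-distribˡ-Σ< (suc s) _ W)) ⟩
    fromℕ (n !) * Σ< (suc s) W
      ∎
    where
    s = n ∸ m
    aⁿ⁺¹ = a ^S suc n
    T : ℕ → Carrier
    T j = q j * transfer (suc n) (m +ℕ j)
    W : ℕ → Carrier
    W i = fromℕ (suc m +ℕ i) * (p i * aⁿ⁺¹ (s ∸ i))
    m+1+s≡1+n : m +ℕ suc s ≡ suc n
    m+1+s≡1+n = ≡.trans (ℕ.+-suc m s) (≡.cong suc (ℕ.m+[n∸m]≡n m≤n))
    length : suc (suc n) ≡ m +ℕ suc (suc s)
    length = ≡.sym (≡.trans (ℕ.+-suc m (suc s)) (≡.cong suc m+1+s≡1+n))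
    T-vanishes : ∀ j → suc (suc s) ≤ j → T j ≈ 0#
    T-vanishes j 2+s≤j =
      trans (*-congˡ (trans (*-congˡ (reflexive (reversal-> (suc n) aⁿ⁺¹ n<m+j))) (zeroʳ _))) (zeroʳ _)
      where
      n<m+j : suc n < m +ℕ j
      n<m+j = ≡.subst (_≤ m +ℕ j) (≡.sym length) (ℕ.+-monoʳ-≤ m 2+s≤j)
    T-suc : ∀ i → i < suc s → T (suc i) ≈ fromℕ (n !) * W i
    T-suc i (s≤s i≤s) = begin
      q (suc i) * (fromℕ ((m +ℕ suc i) *ℕ n !) * reversal (suc n) aⁿ⁺¹ (m +ℕ suc i))
        ≈⟨ *-congˡ (*-cong weight (reflexive coefficient)) ⟩
      p i * (fromℕ (suc m +ℕ i) * fromℕ (n !) * aⁿ⁺¹ (s ∸ i))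
        ≈⟨ regroup _ _ _ _ ⟩
      fromℕ (n !) * W i
        ∎
      where
      regroup : ∀ x y z w → x * (y * z * w) ≈ z * (y * (x * w))
      regroup = solve 4 (λ x y z w → x :* (y :* z :* w) := z :* (y :* (x :* w))) refl
      weight : fromℕ ((m +ℕ suc i) *ℕ n !) ≈ fromℕ (suc m +ℕ i) * fromℕ (n !)
      weight = trans (reflexive (≡.cong (λ l → fromℕ (l *ℕ n !)) (ℕ.+-suc m i)))
                     (fromℕ-* (suc m +ℕ i) (n !))
      coefficient : reversal (suc n) aⁿ⁺¹ (m +ℕ suc i) ≡ aⁿ⁺¹ (s ∸ i)
      coefficient = ≡.trans
        (reversal-≤ (suc n) aⁿ⁺¹ (≡.subst (m +ℕ suc i ≤_) m+1+s≡1+n (ℕ.+-monoʳ-≤ m (s≤s i≤s))))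
        (≡.cong aⁿ⁺¹ (≡.trans (≡.cong (_∸ (m +ℕ suc i)) (≡.sym m+1+s≡1+n))
                               (ℕ.[m+n]∸[m+o]≡n∸o m (suc s) (suc i))))

  transfer-step : ∀ n m → m ≤ n →
    fromℕ (n !) * (fromℕ (suc m) * (a ^S n) (n ∸ m) + (θ p ·S (a ^S suc n)) (n ∸ m)) ≈
    fromℕ (suc n) * transfer n m
  transfer-step zero zero _ = *-congˡ (begin
    fromℕ 1 * 1# + (θ p ·S (a ^S 1)) 0
      ≈⟨ +-congˡ (trans (+-identityʳ _) (trans (*-congʳ (zeroˡ (p 0))) (zeroˡ _))) ⟩
    fromℕ 1 * 1# + 0#
      ≈⟨ trans (+-identityʳ _) (*-identityʳ _) ⟩
    1# + 0#
      ≈⟨ +-identityʳ 1# ⟩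
    1#
      ∎)
  transfer-step (suc n) m m≤1+n = begin
    fromℕ (suc n !) * (fromℕ (suc m) * C + Y)
      ≈⟨ *-congʳ (fromℕ-* (suc n) (n !)) ⟩
    fromℕ (suc n) * F * (fromℕ (suc m) * C + Y)
      ≈⟨ expand _ _ _ _ _ ⟩
    F * (fromℕ (suc n) * fromℕ (suc m) * C + fromℕ (suc n) * Y)
      ≈⟨ *-congˡ (+-congʳ (*-congʳ weights)) ⟩
    F * ((fromℕ (suc (suc n)) * fromℕ m + fromℕ s) * C + fromℕ (suc n) * Y)
      ≈⟨ collect _ _ _ _ _ _ ⟩
    fromℕ (suc (suc n)) * (fromℕ m * F * C) + F * (fromℕ s * C + fromℕ (suc n) * Y)
      ≈⟨ +-congˡ (trans (*-congˡ θ-relation) (zeroʳ F)) ⟩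
    fromℕ (suc (suc n)) * (fromℕ m * F * C) + 0#
      ≈⟨ +-identityʳ _ ⟩
    fromℕ (suc (suc n)) * (fromℕ m * F * C)
      ≈⟨ *-congˡ (*-cong (fromℕ-* m (n !)) (reflexive (reversal-≤ (suc n) (a ^S suc n) m≤1+n))) ⟨
    fromℕ (suc (suc n)) * transfer (suc n) m
      ∎
    where
    s = suc n ∸ m
    F = fromℕ (n !)
    C = (a ^S suc n) s
    Y = (θ p ·S (a ^S suc (suc n))) s
    expand : ∀ x y z w v → x * y * (z * w + v) ≈ y * (x * z * w + x * v)
    expand = solve 5 (λ x y z w v → x :* y :* (z :* w :+ v) := y :* (x :* z :* w :+ x :* v)) refl
    collect : ∀ x y z w u v → x * ((y * z + w) * u + v) ≈ y * (z * x * u) + x * (w * u + v)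
    collect = solve 6 (λ x y z w u v →
      x :* ((y :* z :+ w) :* u :+ v) := y :* (z :* x :* u) :+ x :* (w :* u :+ v)) refl
    θ-relation : fromℕ s * C + fromℕ (suc n) * Y ≈ 0#
    θ-relation = trans (+-congˡ (sym (constS-·S (fromℕ (suc n)) (θ p ·S (a ^S suc (suc n))) s)))
                       (θa^n+nθp·a^[1+n]≈0 (suc n) s)
    weights-ℕ : suc n *ℕ suc m ≡ suc (suc n) *ℕ m +ℕ s
    weights-ℕ = ≡.subst (λ l → l *ℕ suc m ≡ suc l *ℕ m +ℕ s) (ℕ.m+[n∸m]≡n m≤1+n) (identity m s)
      where
      identity : ∀ m s → (m +ℕ s) *ℕ suc m ≡ suc (m +ℕ s) *ℕ m +ℕ s
      identity = solve-∀
    weights : fromℕ (suc n) * fromℕ (suc m) ≈ fromℕ (suc (suc n)) * fromℕ m + fromℕ s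
    weights = begin
      fromℕ (suc n) * fromℕ (suc m)               ≈⟨ fromℕ-* (suc n) (suc m) ⟨
      fromℕ (suc n *ℕ suc m)                      ≡⟨ ≡.cong fromℕ weights-ℕ ⟩
      fromℕ (suc (suc n) *ℕ m +ℕ s)               ≈⟨ fromℕ-+ (suc (suc n) *ℕ m) s ⟩
      fromℕ (suc (suc n) *ℕ m) + fromℕ s          ≈⟨ +-congʳ (fromℕ-* (suc (suc n)) m) ⟩
      fromℕ (suc (suc n)) * fromℕ m + fromℕ s     ∎

  transfer-lowering : q 0 ≈ 0# → ∀ n m → m ≤ n →
    toeplitz q (suc n) (transfer (suc n)) m ≈ fromℕ (suc n) * transfer n m
  transfer-lowering q0≈0 n m m≤n = begin
    toeplitz q (suc n) (transfer (suc n)) m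
      ≈⟨ toeplitz-transfer q0≈0 n m m≤n ⟩
    fromℕ (n !) * Σ< (suc s) (λ i → fromℕ (suc m +ℕ i) * (p i * aⁿ⁺¹ (s ∸ i)))
      ≈⟨ *-congˡ (·S-weighted (suc m) p aⁿ⁺¹ s) ⟩
    fromℕ (n !) * (fromℕ (suc m) * (p ·S aⁿ⁺¹) s + (θ p ·S aⁿ⁺¹) s)
      ≈⟨ *-congˡ (+-congʳ (*-congˡ (p·a^[1+n]≈a^n n s))) ⟩
    fromℕ (n !) * (fromℕ (suc m) * (a ^S n) s + (θ p ·S aⁿ⁺¹) s)
      ≈⟨ transfer-step n m m≤n ⟩
    fromℕ (suc n) * transfer n m
      ∎
    where
    s = n ∸ m
    aⁿ⁺¹ = a ^S suc n

module BasicSequences {c ℓ : Level} (K : Field c ℓ) (q a : FieldTheory.Series K)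
                      (δ : FieldTheory.IsDelta K q) (a·p≈1 : FieldTheory.IsDOverQ K q a)
                      (φ : ℕ → ℕ → Field.Carrier K) (basic : FieldTheory.IsBasicSeq K q φ) where
  open Field K
  open FieldTheory K
  open FormalPowerSeries K
  open DeltaOperators K
  open TransferFormula K q a a·p≈1
  open IsBasicSeq basic
  open import Algebra.Properties.CommutativeSemigroup *-commutativeSemigroup using (x∙yz≈y∙xz)
  open import Relation.Binary.Reasoning.Setoid setoid

  divided-lowering : ∀ n m → toeplitz q (suc n) (divided (φ (suc n))) m ≈ fromℕ (suc n) * divided (φ n) m
  divided-lowering n m = begin
    toeplitz q (suc n) (divided (φ (suc n))) m      ≈⟨ applyOp≈toeplitz-divided q (suc n) (φ (suc n)) m ⟨
    fromℕ (m !) * applyOp q (suc n) (φ (suc n)) m   ≈⟨ *-congˡ (lowering n m) ⟩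
    fromℕ (m !) * (fromℕ (suc n) * φ n m)           ≈⟨ x∙yz≈y∙xz _ _ _ ⟩
    fromℕ (suc n) * divided (φ n) m                 ∎

  divided≈transfer : ∀ n k → divided (φ n) k ≈ transfer n k
  divided≈transfer zero k = trans (*-congˡ (φ₀ k)) (k!*oneS k)
    where
    k!*oneS : ∀ k → fromℕ (k !) * oneS k ≈ oneS k
    k!*oneS zero    = trans (*-identityʳ _) (+-identityʳ 1#)
    k!*oneS (suc k) = zeroʳ _
  divided≈transfer (suc n) = toeplitz-injective δ n φ-deg transfer-deg at-0 (λ m m≤n → begin
    toeplitz q (suc n) (divided (φ (suc n))) m   ≈⟨ divided-lowering n m ⟩
    fromℕ (suc n) * divided (φ n) m              ≈⟨ *-congˡ (divided≈transfer n m) ⟩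
    fromℕ (suc n) * transfer n m                 ≈⟨ transfer-lowering (proj₁ δ) n m m≤n ⟨
    toeplitz q (suc n) (transfer (suc n)) m      ∎)
    where
    φ-deg : ∀ k → suc n < k → divided (φ (suc n)) k ≈ 0#
    φ-deg k n<k = trans (*-congˡ (deg-bound (suc n) k n<k)) (zeroʳ _)
    transfer-deg : ∀ k → suc n < k → transfer (suc n) k ≈ 0#
    transfer-deg k n<k = trans (*-congˡ (reflexive (reversal-> (suc n) (a ^S suc n) n<k))) (zeroʳ _)
    at-0 : divided (φ (suc n)) 0 ≈ transfer (suc n) 0
    at-0 = trans (trans (*-congˡ (vanish₀ n)) (zeroʳ _)) (sym (zeroˡ _))

mainTheorem15 : ∀ {c ℓ : Level} (K : Field c ℓ) →
    let open Field K in let open FieldTheory K in CharZero →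
    (q : Series) → IsDelta q → (a : Series) → IsDOverQ q a → (φ : ℕ → ℕ → Carrier) → IsBasicSeq q φ →
    ∀ n k → 1 ≤ k → k ≤ n →
    fromℕ ((n ∸ k) !) * (a ^S n) (n ∸ k) ≈ φ n k * (fromℕ ((n ∸ 1) C (k ∸ 1)) ⁻¹)
mainTheorem15 K char0 q δ a a·p≈1 φ basic (suc n) (suc k) (s≤s _) (s≤s k≤n) =
  y≈x*z⇒z≈y*x⁻¹ (fromℕ-nonZero char0 (n C k) {{nCk≢0 k≤n}})
    (*-cancelˡ-nonZero (fromℕ (suc k !)) _ _ (fromℕ-nonZero char0 (suc k !) {{suc k ℕ.!≢0}}) (begin
      fromℕ (suc k !) * φ (suc n) (suc k)
        ≈⟨ divided≈transfer (suc n) (suc k) ⟩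
      fromℕ (suc k *ℕ n !) * reversal (suc n) (a ^S suc n) (suc k)
        ≡⟨ ≡.cong₂ (λ l x → fromℕ l * x) ([1+k]*n!≡[1+k]!*[nCk*[n∸k]!] k≤n)
                                          (reversal-≤ (suc n) (a ^S suc n) (s≤s k≤n)) ⟩
      fromℕ (suc k ! *ℕ ((n C k) *ℕ (n ∸ k) !)) * (a ^S suc n) (n ∸ k)
        ≈⟨ *-congʳ (trans (fromℕ-* (suc k !) _) (*-congˡ (fromℕ-* (n C k) _))) ⟩
      fromℕ (suc k !) * (fromℕ (n C k) * fromℕ ((n ∸ k) !)) * (a ^S suc n) (n ∸ k)
        ≈⟨ trans (*-assoc _ _ _) (*-congˡ (*-assoc _ _ _)) ⟩
      fromℕ (suc k !) * (fromℕ (n C k) * (fromℕ ((n ∸ k) !) * (a ^S suc n) (n ∸ k)))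
        ∎))
  where
  open Field K
  open FieldTheory K
  open FieldArithmetic K
  open FormalPowerSeries K
  open BasicSequences K q a δ a·p≈1 φ basic
  open import Relation.Binary.Reasoning.Setoid setoid
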